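{- Let $\mathcal{P}$ be a simple polygraphic program with a fixed simple interpretation $((\cdot)_*,[\cdot])$ compatible with its computation $3$-cells, and let $a\in\mathbb{N}^*$ bound all the constants $a_\gamma=\gamma_*(0,\dots,0)$ for $\gamma$ a constructor. Then for every value $t$ of $\mathcal{P}$, $|t|\le t_*\le a\,|t|$ in $\mathbb{N}$.
   Context: A monoidal $3$-polygraph consists of $1$-cells (sorts), $1$-paths (finite words of $1$-cells, concatenation $\star_0$, empty word $\ast$), $2$-cells $\phi:s_1(\phi)\Rightarrow t_1(\phi)$ between $1$-paths, $2$-paths (morphisms of the free strict monoidal category generated by $1$- and $2$-cells, i.e. circuits modulo deformation, with sequential composition $\star_1$ and parallel composition $\star_0$), and $3$-cells (rewriting rules) between parallel $2$-paths. A polygraphic program is such a polygraph whose $2$-cells are structure $2$-cells $\tau_{\xi,\zeta}:\xi\star_0\zeta\Rightarrow\zeta\star_0\xi$, $\delta_\xi:\xi\Rightarrow\xi\star_0\xi$, $\varepsilon_\xi:\xi\Rightarrow\ast$, constructors (whose $1$-target is a single $1$-cell) and functions (other $2$-cells); its $3$-cells are structure $3$-cells (letting constructors commute through $\tau$, be duplicated by $\delta$ and erased by $\varepsilon$) and computation $3$-cells whose $2$-source is $t\star_1\phi$ with $\phi$ a function and $t$ built from $1$-cells and constructors. A value of type $\xi$ is a $2$-path built only from constructors, with no input and with $1$-target $\xi$. For a $2$-path $f$, $|f|$ denotes the number of $2$-cells it is made of. A polygraphic interpretation assigns to each $2$-path $f$ with $m$ inputs and $n$ outputs monotone maps $f_*:\mathbb{N}^m\to\mathbb{N}^n$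 and $[f]:\mathbb{N}^m\to\mathbb{N}$ with $x_*=\mathrm{id}$, $[x]=0$ for $1$-paths $x$, $(f\star_0g)_*=(f_*,g_*)$, $[f\star_0 g](\vec x,\vec y)=[f](\vec x)+[g](\vec y)$, $(f\star_1g)_*=g_*\circ f_*$, $[f\star_1 g](\vec x)=[f](\vec x)+[g](f_*(\vec x))$; it is compatible with a $3$-cell $\alpha$ if $s_2(\alpha)_*\ge t_2(\alpha)_*$ componentwise and $[s_2(\alpha)]>[t_2(\alpha)]$ pointwise. It is simple if: for each $2$-cell $\phi$ with $m$ inputs, $n$ outputs, $\sum_j\phi^j_*$ and $[\phi]$ lie in $\mathbb{N}[x_1,\dots,x_m]$; each constructor $\gamma$ with $m$ inputs has $\gamma_*=\sum_{i=1}^m x_i+a_\gamma$, $a_\gamma>0$, $[\gamma]=0$; $(\tau)_*(i,j)=(j,i)$, $(\delta)_*(i)=(i,i)$, and $\tau,\delta,\varepsilon$ have heat $0$; each function satisfies $\sum_j\phi^j_*(i_1,\dots,i_m)\ge i_1+\cdots+i_m$. A program is simple if the $2$-targets of its computation $3$-cells contain at most $K$ structure $2$-cells for a fixed $K$ and it has a simple interpretation compatible with all computation $3$-cells. For a value $t$ (no input, one output), $t_*$ is a natural number. -}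

module Defs where

open import Data.Nat using (ℕ; zero; suc; _+_; _*_; _≤_; _<_; _≥_; _>_)
open import Data.Fin using (Fin)
open import Data.List using (List; []; _∷_; _++_; length)
open import Data.Vec using (Vec; []; _∷_; lookup)
open import Data.Product using (Σ; _×_; _,_; proj₁; proj₂; ∃)
open import Data.Unit using (⊤; tt)
open import Relation.Binary.PropositionalEquality using (_≡_)

-- Signature of a polygraphic program: 1-cells (sorts), constructors,
-- functions, and computation 3-cells.  1-paths are lists of sorts.

record Signature : Set₁ where
  field
    Sort   : Set
    Con    : Set
    conIn  : Con → List Sort
    conOut : Con → Sort
    Fun    : Set
    funIn  : Fun → List Sort
    funOut : Fun → List Sort

module _ (S : Signature) where
  open Signature S

  data Gen : List Sort → List Sort → Set where
    τ   : (ξ ζ : Sort) → Gen (ξ ∷ ζ ∷ []) (ζ ∷ ξ ∷ [])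
    δ   : (ξ : Sort) → Gen (ξ ∷ []) (ξ ∷ ξ ∷ [])
    ε   : (ξ : Sort) → Gen (ξ ∷ []) []
    con : (c : Con) → Gen (conIn c) (conOut c ∷ [])
    fun : (f : Fun) → Gen (funIn f) (funOut f)

  -- 2-paths: terms of the free strict monoidal category (representatives
  -- of circuits; all notions below are invariant under deformation)
  data Path2 : List Sort → List Sort → Set where
    gen  : ∀ {x y} → Gen x y → Path2 x y
    idp  : (x : List Sort) → Path2 x x
    _⋆₁_ : ∀ {x y z} → Path2 x y → Path2 y z → Path2 x z
    _⋆₀_ : ∀ {x y x' y'} → Path2 x y → Path2 x' y' → Path2 (x ++ x') (y ++ y')

  isStructure : ∀ {x y} → Gen x y → ℕ
  isStructure (τ _ _) = 1
  isStructure (δ _)   = 1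
  isStructure (ε _)   = 1
  isStructure (con _) = 0
  isStructure (fun _) = 0

  size : ∀ {x y} → Path2 x y → ℕ
  size (gen g)  = 1
  size (idp x)  = 0
  size (f ⋆₁ g) = size f + size g
  size (f ⋆₀ g) = size f + size g

  nStruct : ∀ {x y} → Path2 x y → ℕ
  nStruct (gen g)  = isStructure g
  nStruct (idp x)  = 0
  nStruct (f ⋆₁ g) = nStruct f + nStruct g
  nStruct (f ⋆₀ g) = nStruct f + nStruct g

  data OnlyCons : ∀ {x y} → Path2 x y → Set where
    oc-con : (c : Con) → OnlyCons (gen (con c))
    oc-id  : (x : List Sort) → OnlyCons (idp x)
    oc-⋆₁  : ∀ {x y z} {f : Path2 x y} {g : Path2 y z} →
             OnlyCons f → OnlyCons g → OnlyCons (f ⋆₁ g)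
    oc-⋆₀  : ∀ {x y x' y'} {f : Path2 x y} {g : Path2 x' y'} →
             OnlyCons f → OnlyCons g → OnlyCons (f ⋆₀ g)

  IsValue : ∀ {ξ} → Path2 [] (ξ ∷ []) → Set
  IsValue t = OnlyCons t

record Program : Set₁ where
  field
    sig     : Signature
    Rule    : Set
    ruleIn  : Rule → List (Signature.Sort sig)
    -- 2-source = t ⋆₁ φ with φ a function and t built from 1-cells and constructors
    ruleFun : Rule → Signature.Fun sig
    ruleArg : (r : Rule) → Path2 sig (ruleIn r) (Signature.funIn sig (ruleFun r))
    ruleArgCons : (r : Rule) → OnlyCons sig (ruleArg r)
    rhs     : (r : Rule) → Path2 sig (ruleIn r) (Signature.funOut sig (ruleFun r))

Tup : ∀ {A : Set} → List A → Set
Tup []      = ⊤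
Tup (_ ∷ x) = ℕ × Tup x

split : ∀ {A : Set} (x : List A) {x' : List A} → Tup (x ++ x') → Tup x × Tup x'
split []      v       = tt , v
split (_ ∷ x) (n , v) with split x v
... | (u , w) = (n , u) , w

join : ∀ {A : Set} {x x' : List A} → Tup x → Tup x' → Tup (x ++ x')
join {x = []}    _       w = w
join {x = _ ∷ x} (n , u) w = n , join u w

sumTup : ∀ {A : Set} {x : List A} → Tup x → ℕ
sumTup {x = []}    _       = 0
sumTup {x = _ ∷ x} (n , v) = n + sumTup v

zeros : ∀ {A : Set} (x : List A) → Tup x
zeros []      = tt
zeros (_ ∷ x) = 0 , zeros x

_≤T_ : ∀ {A : Set} {x : List A} → Tup x → Tup x → Set
_≤T_ {x = []}    _       _       = ⊤
_≤T_ {x = _ ∷ x} (m , u) (n , v) = m ≤ n × u ≤T v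

toVec : ∀ {A : Set} {x : List A} → Tup x → Vec ℕ (length x)
toVec {x = []}    _       = []
toVec {x = _ ∷ x} (n , v) = n ∷ toVec v

data Poly (n : ℕ) : Set where
  cst  : ℕ → Poly n
  var  : Fin n → Poly n
  _⊕_  : Poly n → Poly n → Poly n
  _⊗_  : Poly n → Poly n → Poly n

evalP : ∀ {n} → Poly n → Vec ℕ n → ℕ
evalP (cst k) v = k
evalP (var i) v = lookup v i
evalP (p ⊕ q) v = evalP p v + evalP q v
evalP (p ⊗ q) v = evalP p v * evalP q v

IsPoly : ∀ {A : Set} {x : List A} → (Tup x → ℕ) → Set
IsPoly {x = x} h = Σ (Poly (length x)) λ p → ∀ v → h v ≡ evalP p (toVec v)

record Interp (S : Signature) : Set where
  field
    gstar : ∀ {x y} → Gen S x y → Tup x → Tup y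
    gheat : ∀ {x y} → Gen S x y → Tup x → ℕ
    gstar-mono : ∀ {x y} (g : Gen S x y) {u v : Tup x} → u ≤T v → gstar g u ≤T gstar g v
    gheat-mono : ∀ {x y} (g : Gen S x y) {u v : Tup x} → u ≤T v → gheat g u ≤ gheat g v

module _ {S : Signature} (I : Interp S) where
  open Interp I

  star : ∀ {x y} → Path2 S x y → Tup x → Tup y
  star (gen g)  v = gstar g v
  star (idp x)  v = v
  star (f ⋆₁ g) v = star g (star f v)
  star (_⋆₀_ {x = x} f g) v = join (star f (proj₁ (split x v))) (star g (proj₂ (split x v)))

  heat : ∀ {x y} → Path2 S x y → Tup x → ℕ
  heat (gen g)  v = gheat g v
  heat (idp x)  v = 0
  heat (f ⋆₁ g) v = heat f v + heat g (star f v)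
  heat (_⋆₀_ {x = x} f g) v = heat f (proj₁ (split x v)) + heat g (proj₂ (split x v))

  valueOf : ∀ {ξ} → Path2 S [] (ξ ∷ []) → ℕ
  valueOf t = proj₁ (star t tt)

  constOf : (c : Signature.Con S) → ℕ
  constOf c = proj₁ (gstar (con c) (zeros (Signature.conIn S c)))

  record Simple : Set where
    field
      poly-out  : ∀ {x y} (g : Gen S x y) → IsPoly (λ v → sumTup (gstar g v))
      poly-heat : ∀ {x y} (g : Gen S x y) → IsPoly (gheat g)
      con-star  : ∀ c → Σ ℕ λ a → a > 0 × (∀ v → proj₁ (gstar (con c) v) ≡ sumTup v + a)
      con-heat  : ∀ c v → gheat (con c) v ≡ 0
      τ-star    : ∀ ξ ζ i j → gstar (τ ξ ζ) (i , j , tt) ≡ (j , i , tt)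
      δ-star    : ∀ ξ i → gstar (δ ξ) (i , tt) ≡ (i , i , tt)
      τ-heat    : ∀ ξ ζ v → gheat (τ ξ ζ) v ≡ 0
      δ-heat    : ∀ ξ v → gheat (δ ξ) v ≡ 0
      ε-heat    : ∀ ξ v → gheat (ε ξ) v ≡ 0
      fun-grow  : ∀ f v → sumTup (gstar (fun f) v) ≥ sumTup v

module _ (P : Program) where
  open Program P

  lhs : (r : Rule) → Path2 sig (ruleIn r) (Signature.funOut sig (ruleFun r))
  lhs r = ruleArg r ⋆₁ gen (fun (ruleFun r))

  StructBound : ℕ → Set
  StructBound K = ∀ r → nStruct sig (rhs r) ≤ K

  Compatible : Interp sig → Set
  Compatible I = ∀ r v →
    star I (rhs r) v ≤T star I (lhs r) v × heat I (lhs r) v > heat I (rhs r) v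

-- A constructor γ raises the sum of its inputs by a_γ ∈ [1, a], so by induction on a circuit of
-- constructors, the sum of its outputs exceeds the sum of its inputs by the sum of the a_γ over
-- its |f| constructors. For a value there are no inputs and one output.
module Submission where

open import Defs
open import Data.Nat using (ℕ; _≤_; _*_; _+_)
open import Data.Nat.Properties
open import Data.List using (List; []; _∷_; _++_)
open import Data.Product using (_×_; _,_; proj₁; proj₂)
open import Data.Unit using (tt)
open import Relation.Binary.PropositionalEquality
open import Algebra.Properties.CommutativeSemigroup +-commutativeSemigroup using (interchange)

module _ {A : Set} where

  sumTup-join : ∀ {x x' : List A} (u : Tup x) (w : Tup x') →
                sumTup (join u w) ≡ sumTup u + sumTup w
  sumTup-join {x = []}    u       w = refl
  sumTup-join {x = _ ∷ x} (n , u) w = trans (cong (n +_) (sumTup-join u w)) (sym (+-assoc n _ _))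

  join-split : ∀ (x : List A) {x' : List A} (v : Tup (x ++ x')) →
               join (proj₁ (split x v)) (proj₂ (split x v)) ≡ v
  join-split []      v       = refl
  join-split (_ ∷ x) (n , v) = cong (n ,_) (join-split x v)

  sumTup-split : ∀ (x : List A) {x' : List A} (v : Tup (x ++ x')) →
                 sumTup v ≡ sumTup (proj₁ (split x v)) + sumTup (proj₂ (split x v))
  sumTup-split x v = trans (cong sumTup (sym (join-split x v))) (sumTup-join {x = x} _ _)

  sumTup-zeros : ∀ (x : List A) → sumTup (zeros x) ≡ 0
  sumTup-zeros []      = refl
  sumTup-zeros (_ ∷ x) = sumTup-zeros x

module _ {S : Signature} {I : Interp S} (sim : Simple I) where
  open Simple sim
  open Signature S using (conIn; conOut)

  constOf-increment : ∀ c → proj₁ (con-star c) ≡ constOf I c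
  constOf-increment c with con-star c
  ... | (aγ , _ , γ-star) = sym (trans (γ-star _) (cong (_+ aγ) (sumTup-zeros (conIn c))))

  constOf-positive : ∀ c → 1 ≤ constOf I c
  constOf-positive c = subst (1 ≤_) (constOf-increment c) (proj₁ (proj₂ (con-star c)))

  sumTup-star-con : ∀ c (v : Tup (conIn c)) →
                    sumTup {x = conOut c ∷ []} (star I (gen (con c)) v) ≡ sumTup v + constOf I c
  sumTup-star-con c v =
    trans (+-identityʳ _) (trans (proj₂ (proj₂ (con-star c)) v)
                                 (cong (sumTup v +_) (constOf-increment c)))

  sumTup-star-lower : ∀ {x y} {f : Path2 S x y} → OnlyCons S f → (v : Tup x) →
                      sumTup v + size S f ≤ sumTup (star I f v)
  sumTup-star-lower (oc-con c) v = begin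
    sumTup v + 1                                       ≤⟨ +-monoʳ-≤ (sumTup v) (constOf-positive c) ⟩
    sumTup v + constOf I c                             ≡⟨ sumTup-star-con c v ⟨
    sumTup {x = conOut c ∷ []} (star I (gen (con c)) v) ∎
    where open ≤-Reasoning
  sumTup-star-lower (oc-id x) v = ≤-reflexive (+-identityʳ _)
  sumTup-star-lower {f = f ⋆₁ g} (oc-⋆₁ of og) v = begin
    sumTup v + (size S f + size S g)    ≡⟨ +-assoc (sumTup v) _ _ ⟨
    sumTup v + size S f + size S g      ≤⟨ +-monoˡ-≤ (size S g) (sumTup-star-lower of v) ⟩
    sumTup (star I f v) + size S g      ≤⟨ sumTup-star-lower og (star I f v) ⟩
    sumTup (star I (f ⋆₁ g) v)          ∎
    where open ≤-Reasoning
  sumTup-star-lower {f = _⋆₀_ {x = x} {y = y} f g} (oc-⋆₀ of og) v = begin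
    sumTup v + (size S f + size S g)                    ≡⟨ cong (_+ _) (sumTup-split x v) ⟩
    (sumTup v₁ + sumTup v₂) + (size S f + size S g)     ≡⟨ interchange (sumTup v₁) _ _ _ ⟩
    (sumTup v₁ + size S f) + (sumTup v₂ + size S g)     ≤⟨ +-mono-≤ (sumTup-star-lower of v₁)
                                                                     (sumTup-star-lower og v₂) ⟩
    sumTup (star I f v₁) + sumTup (star I g v₂)         ≡⟨ sumTup-join {x = y} _ _ ⟨
    sumTup (star I (f ⋆₀ g) v)                          ∎
    where
      open ≤-Reasoning
      v₁ = proj₁ (split x v)
      v₂ = proj₂ (split x v)

  module _ {a : ℕ} (constOf≤a : ∀ c → constOf I c ≤ a) where

    sumTup-star-upper : ∀ {x y} {f : Path2 S x y} → OnlyCons S f → (v : Tup x) →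
                        sumTup (star I f v) ≤ sumTup v + a * size S f
    sumTup-star-upper (oc-con c) v = begin
      sumTup {x = conOut c ∷ []} (star I (gen (con c)) v) ≡⟨ sumTup-star-con c v ⟩
      sumTup v + constOf I c                              ≤⟨ +-monoʳ-≤ (sumTup v) (constOf≤a c) ⟩
      sumTup v + a                                        ≡⟨ cong (sumTup v +_) (*-identityʳ a) ⟨
      sumTup v + a * 1                                    ∎
      where open ≤-Reasoning
    sumTup-star-upper (oc-id x) v =
      ≤-reflexive (sym (trans (cong (sumTup v +_) (*-zeroʳ a)) (+-identityʳ _)))
    sumTup-star-upper {f = f ⋆₁ g} (oc-⋆₁ of og) v = begin
      sumTup (star I (f ⋆₁ g) v)               ≤⟨ sumTup-star-upper og (star I f v) ⟩
      sumTup (star I f v) + a * size S g       ≤⟨ +-monoˡ-≤ (a * size S g) (sumTup-star-upper of v) ⟩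
      sumTup v + a * size S f + a * size S g   ≡⟨ +-assoc (sumTup v) _ _ ⟩
      sumTup v + (a * size S f + a * size S g) ≡⟨ cong (sumTup v +_) (*-distribˡ-+ a (size S f) _) ⟨
      sumTup v + a * (size S f + size S g)     ∎
      where open ≤-Reasoning
    sumTup-star-upper {f = _⋆₀_ {x = x} {y = y} f g} (oc-⋆₀ of og) v = begin
      sumTup (star I (f ⋆₀ g) v)                              ≡⟨ sumTup-join {x = y} _ _ ⟩
      sumTup (star I f v₁) + sumTup (star I g v₂)             ≤⟨ +-mono-≤ (sumTup-star-upper of v₁)
                                                                          (sumTup-star-upper og v₂) ⟩
      (sumTup v₁ + a * size S f) + (sumTup v₂ + a * size S g) ≡⟨ interchange (sumTup v₁) _ _ _ ⟩
      (sumTup v₁ + sumTup v₂) + (a * size S f + a * size S g) ≡⟨ cong₂ _+_ (sumTup-split x v)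
                                                                          (*-distribˡ-+ a (size S f) _) ⟨
      sumTup v + a * (size S f + size S g)                    ∎
      where
        open ≤-Reasoning
        v₁ = proj₁ (split x v)
        v₂ = proj₂ (split x v)

lemma4p2 : (P : Program) (K : ℕ) → StructBound P K →
           (I : Interp (Program.sig P)) → Simple I → Compatible P I →
           (a : ℕ) → 1 ≤ a → (∀ c → constOf I c ≤ a) →
           ∀ {ξ} (t : Path2 (Program.sig P) [] (ξ ∷ [])) → IsValue (Program.sig P) t →
           size (Program.sig P) t ≤ valueOf I t × valueOf I t ≤ a * size (Program.sig P) t
lemma4p2 P _ _ I sim _ a _ constOf≤a t t-value =
  subst (size S t ≤_) (+-identityʳ (valueOf I t)) (sumTup-star-lower sim t-value tt) ,
  subst (_≤ a * size S t) (+-identityʳ (valueOf I t)) (sumTup-star-upper sim constOf≤a t-value tt)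
  where S = Program.sig P
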